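{- A string $w$ is a MUPS of $S$ if and only if there is a node $v$ in $\mathsf{eertree}(S)$ such that $\mathit{pal}(v) = w$, $\mathit{pal}(v)$ is unique in $S$, and $\mathit{pal}(u)$ is repeating in $S$, where $u$ is the parent of $v$.
   Context: The eertree $\mathsf{eertree}(S)$ of a string $S$ has one ordinary node $v$ for each distinct non-empty palindromic substring $\mathit{pal}(v)$ of $S$, plus two auxiliary nodes ($\mathtt{0}$-node and $\mathtt{ -1}$-node, both representing the empty string $\varepsilon$). There is an edge $(u,v)$ (so $u$ is the parent of $v$) iff $|\mathit{pal}(v)| = |\mathit{pal}(u)|+2$ and $\mathit{pal}(u) = \mathit{pal}(v)[1..|\mathit{pal}(v)|-2]$. A non-empty string is unique in $S$ if it occurs exactly once, and repeating if it occurs at least twice; the empty string is considered repeating. A substring $S[i..j]$ is a minimal unique palindromic substring (MUPS) of $S$ iff $S[i..j]$ is a palindrome, unique in $S$, and $S[i+1..j-1]$ is repeating in $S$. -}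

module Defs where

open import Data.Nat using (ℕ; zero; suc; _≤_; _<_; _∸_)
open import Data.Integer using (ℤ; +_; -[1+_]) renaming (_+_ to _+ℤ_)
open import Data.List using (List; []; _∷_; _++_; length; take; drop; reverse)
open import Data.Product using (Σ; ∃; ∃-syntax; _×_; _,_)
open import Data.Sum using (_⊎_)
open import Relation.Nullary using (¬_)
open import Relation.Binary.PropositionalEquality using (_≡_; _≢_)

-- Strings over an arbitrary alphabet A are lists; positions are 0-indexed.

Sub : {A : Set} → List A → ℕ → ℕ → List A
Sub S i ℓ = take ℓ (drop i S)

-- S[i..j] (0-indexed, inclusive); S[i..j] = ε when j < i
Range : {A : Set} → List A → ℕ → ℕ → List A
Range S i j = Sub S i (suc j ∸ i)

Palindrome : {A : Set} → List A → Set
Palindrome w = reverse w ≡ w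

OccursAt : {A : Set} → List A → List A → ℕ → Set
OccursAt S w i = Σ (List _) λ p → Σ (List _) λ q → (S ≡ p ++ w ++ q) × (length p ≡ i)

IsSubstring : {A : Set} → List A → List A → Set
IsSubstring S w = ∃[ i ] OccursAt S w i

Unique : {A : Set} → List A → List A → Set
Unique S w = (w ≢ []) × (∃[ i ] (OccursAt S w i × (∀ j → OccursAt S w j → j ≡ i)))

-- occurs at least twice; the empty string is repeating by convention
Repeating : {A : Set} → List A → List A → Set
Repeating S w = (w ≡ []) ⊎ (∃[ i ] ∃[ j ] (OccursAt S w i × OccursAt S w j × i ≢ j))

IsMUPSAt : {A : Set} → List A → ℕ → ℕ → Set
IsMUPSAt S i j =
  i ≤ j × j < length S × Palindrome (Range S i j)
  × Unique S (Range S i j) × Repeating S (Range S (suc i) (j ∸ 1))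

IsMUPS : {A : Set} → List A → List A → Set
IsMUPS S w = ∃[ i ] ∃[ j ] (IsMUPSAt S i j × Range S i j ≡ w)

-- Nodes of eertree(S): one ordinary node per distinct non-empty palindromic
-- substring (indexed by the string itself), plus the 0-node and the -1-node.
data Node {A : Set} (S : List A) : Set where
  ordinary  : (w : List A) → w ≢ [] → Palindrome w → IsSubstring S w → Node S
  zeroNode  : Node S
  minusNode : Node S

pal : {A : Set} {S : List A} → Node S → List A
pal (ordinary w _ _ _) = w
pal zeroNode = []
pal minusNode = []

len : {A : Set} {S : List A} → Node S → ℤ
len (ordinary w _ _ _) = + length w
len zeroNode = + 0
len minusNode = -[1+ 0 ]

Edge : {A : Set} {S : List A} → Node S → Node S → Set
Edge u v = (len v ≡ len u +ℤ + 2) × (pal u ≡ Sub (pal v) 1 (length (pal v) ∸ 2))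

module Submission where

-- Let inner X denote X with its first and last symbols removed,
-- inner X = X[1..|X|-2].  Both sides of the equivalence turn out to say the
-- same thing about w, namely
--
--     w is a palindrome, w is unique in S, and inner w is repeating in S,
--
-- which we call a minimal unique palindrome (MinimalUniquePalindrome).
--
-- MUPS side: for i ≤ j < |S| the string S[i+1..j-1] is exactly
-- inner (S[i..j]) (rangeInner), and conversely every occurrence
-- S = p ++ w ++ q of a non-empty w is the range S[|p|..|p|+|w|-1]
-- (occurrenceRange).
--
-- Eertree side: by definition of Edge the parent u of a node v has
-- pal u = inner (pal v); conversely every non-empty palindrome R of S whose
-- inner string is repeating has a parent node in the eertree (parentNode):
-- the -1-node if |R| = 1, the 0-node if |R| = 2, and the ordinary node of
-- inner R otherwise.

open import Defs
open import Data.List using (List; []; _∷_; _++_; _∷ʳ_; length; take; drop; reverse; _∷ʳ′_; initLast)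
open import Data.List.Properties using (length-take; take-take; length-drop; drop-drop; length-++; reverse-++; unfold-reverse; ∷-injective; ∷ʳ-injectiveˡ)
open import Data.Nat using (ℕ; suc; _≤_; _<_; _∸_; _+_; s≤s)
open import Data.Nat.Properties using (m≤n⇒m⊓n≡m; m∸n≤m; ∸-+-assoc; +-∸-assoc; ∸-monoˡ-≤; m≤m+n; +-comm; +-suc; m+n∸m≡n; +-monoʳ-≤)
open import Data.Integer using (+_)
open import Data.Product using (_×_; ∃-syntax; _,_)
open import Data.Sum using (inj₁; inj₂)
open import Data.Empty using (⊥-elim)
open import Function.Bundles using (_⇔_; mk⇔)
open import Function.Properties.Equivalence using () renaming (trans to ⇔-trans)
open import Relation.Binary.PropositionalEquality using (_≡_; _≢_; refl; sym; trans; cong; cong₂; subst; module ≡-Reasoning)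

private
  variable
    A : Set

inner : List A → List A
inner X = Sub X 1 (length X ∸ 2)

take-length-++ : (p ys : List A) → take (length p) (p ++ ys) ≡ p
take-length-++ []      ys = refl
take-length-++ (z ∷ p) ys = cong (z ∷_) (take-length-++ p ys)

drop-length-++ : (p ys : List A) → drop (length p) (p ++ ys) ≡ ys
drop-length-++ []      ys = refl
drop-length-++ (z ∷ p) ys = drop-length-++ p ys

inner-enclose : (x : A) (m : List A) (y : A) → inner (x ∷ m ∷ʳ y) ≡ m
inner-enclose x m y rewrite length-++ m {y ∷ []} | +-comm (length m) 1 = take-length-++ m (y ∷ [])

-- A palindrome of the form x ∷ m ∷ʳ y has a palindromic middle part m:
-- reversing gives y ∷ reverse m ∷ʳ x = x ∷ m ∷ʳ y, and we cancel both ends.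
enclosed-palindrome : (x : A) (m : List A) (y : A) → Palindrome (x ∷ m ∷ʳ y) → Palindrome m
enclosed-palindrome x m y pal with ∷-injective reversed
  where
  open ≡-Reasoning
  reversed : y ∷ (reverse m ∷ʳ x) ≡ x ∷ m ∷ʳ y
  reversed = begin
    y ∷ (reverse m ∷ʳ x)      ≡⟨ cong (_∷ʳ x) (sym (reverse-++ m (y ∷ []))) ⟩
    reverse (m ∷ʳ y) ∷ʳ x     ≡⟨ sym (unfold-reverse x (m ∷ʳ y)) ⟩
    reverse (x ∷ m ∷ʳ y)      ≡⟨ pal ⟩
    x ∷ m ∷ʳ y                ∎
... | refl , middle = ∷ʳ-injectiveˡ (reverse m) m middle

inner-take : (Y : List A) (d : ℕ) → suc d ≤ length Y → inner (take (suc d) Y) ≡ take (d ∸ 1) (drop 1 Y)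
inner-take (y ∷ Y) d (s≤s d≤|Y|)
  rewrite length-take d Y | m≤n⇒m⊓n≡m d≤|Y| | take-take (d ∸ 1) d Y | m≤n⇒m⊓n≡m (m∸n≤m d 1) = refl

rangeInner : (S : List A) (i j : ℕ) → i ≤ j → j < length S → Range S (suc i) (j ∸ 1) ≡ inner (Range S i j)
rangeInner S i j i≤j j<|S| = sym (begin
  inner (take (suc j ∸ i) (drop i S))       ≡⟨ cong (λ n → inner (take n (drop i S))) (+-∸-assoc 1 i≤j) ⟩
  inner (take (suc (j ∸ i)) (drop i S))     ≡⟨ inner-take (drop i S) (j ∸ i) fits ⟩
  take (j ∸ i ∸ 1) (drop 1 (drop i S))      ≡⟨ cong₂ take lengths (drop-drop i 1 S) ⟩
  take (j ∸ 1 ∸ i) (drop (i + 1) S)         ≡⟨ cong (λ k → take (j ∸ 1 ∸ i) (drop k S)) (+-comm i 1) ⟩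
  take (j ∸ 1 ∸ i) (drop (suc i) S)         ∎)
  where
  open ≡-Reasoning
  fits : suc (j ∸ i) ≤ length (drop i S)
  fits rewrite length-drop i S | sym (+-∸-assoc 1 i≤j) = ∸-monoˡ-≤ i j<|S|
  lengths : j ∸ i ∸ 1 ≡ j ∸ 1 ∸ i
  lengths = trans (∸-+-assoc j i 1) (trans (cong (j ∸_) (+-comm i 1)) (sym (∸-+-assoc j 1 i)))

occurrenceRange : (S p w q : List A) → w ≢ [] → S ≡ p ++ w ++ q →
  ∃[ j ] (length p ≤ j × j < length S × Range S (length p) j ≡ w)
occurrenceRange S p []       q w≢[] _    = ⊥-elim (w≢[] refl)
occurrenceRange S p (a ∷ ws) q _    refl = length p + length ws , m≤m+n (length p) (length ws) , inside , isRange
  where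
  open ≡-Reasoning
  isRange : Range (p ++ (a ∷ ws) ++ q) (length p) (length p + length ws) ≡ a ∷ ws
  isRange = begin
    take (suc (length p + length ws) ∸ length p) (drop (length p) (p ++ (a ∷ ws) ++ q))
      ≡⟨ cong (λ n → take (n ∸ length p) (drop (length p) (p ++ (a ∷ ws) ++ q))) (sym (+-suc (length p) (length ws))) ⟩
    take (length p + suc (length ws) ∸ length p) (drop (length p) (p ++ (a ∷ ws) ++ q))
      ≡⟨ cong₂ take (m+n∸m≡n (length p) (suc (length ws))) (drop-length-++ p ((a ∷ ws) ++ q)) ⟩
    take (length (a ∷ ws)) ((a ∷ ws) ++ q)
      ≡⟨ take-length-++ (a ∷ ws) q ⟩
    a ∷ ws ∎
  inside : length p + length ws < length (p ++ (a ∷ ws) ++ q)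
  inside rewrite length-++ p {(a ∷ ws) ++ q} | length-++ (a ∷ ws) {q} | +-suc (length p) (length ws + length q)
    = s≤s (+-monoʳ-≤ (length p) (m≤m+n (length ws) (length q)))

MinimalUniquePalindrome : List A → List A → Set
MinimalUniquePalindrome S w = Palindrome w × Unique S w × Repeating S (inner w)

isMUPS⇔minimal : (S w : List A) → IsMUPS S w ⇔ MinimalUniquePalindrome S w
isMUPS⇔minimal S w = mk⇔ toMinimal fromMinimal
  where
  toMinimal : IsMUPS S w → MinimalUniquePalindrome S w
  toMinimal (i , j , (i≤j , j<|S| , pal , unique , repeating) , range≡w) =
    subst (MinimalUniquePalindrome S) range≡w
      (pal , unique , subst (Repeating S) (rangeInner S i j i≤j j<|S|) repeating)
  fromMinimal : MinimalUniquePalindrome S w → IsMUPS S w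
  fromMinimal (pal , unique@(w≢[] , _ , (p , q , S≡pwq , _) , _) , repeating)
    with occurrenceRange S p w q w≢[] S≡pwq
  ... | j , i≤j , j<|S| , range≡w =
    length p , j ,
    ( i≤j , j<|S|
    , subst Palindrome (sym range≡w) pal
    , subst (Unique S) (sym range≡w) unique
    , subst (Repeating S) (sym (trans (rangeInner S (length p) j i≤j j<|S|) (cong inner range≡w))) repeating) ,
    range≡w

length-enclose : (x : A) (m : List A) (y : A) → + length (x ∷ m ∷ʳ y) ≡ + (length m + 2)
length-enclose x m y = cong +_ (trans (cong suc (length-++ m {y ∷ []})) (sym (+-suc (length m) 1)))

repeating-substring : {S w : List A} → w ≢ [] → Repeating S w → IsSubstring S w
repeating-substring w≢[] (inj₁ w≡[])                 = ⊥-elim (w≢[] w≡[])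
repeating-substring _    (inj₂ (i , _ , occurs , _)) = i , occurs

parentNode : (S R : List A) (R≢[] : R ≢ []) (palR : Palindrome R) (occR : IsSubstring S R) →
  Repeating S (inner R) → ∃[ u ] (Edge u (ordinary R R≢[] palR occR) × Repeating S (pal u))
parentNode S []      R≢[] _    _ _ = ⊥-elim (R≢[] refl)
parentNode S (x ∷ R) _    palR _ repeating with initLast R
... | []             = minusNode , (refl , refl) , inj₁ refl
... | []      ∷ʳ′ y  = zeroNode , (refl , refl) , inj₁ refl
... | (a ∷ m) ∷ʳ′ y  =
  ordinary (a ∷ m) (λ ()) (enclosed-palindrome x (a ∷ m) y palR) (repeating-substring (λ ()) repeatingMiddle) ,
  (length-enclose x (a ∷ m) y , sym (inner-enclose x (a ∷ m) y)) ,
  repeatingMiddle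
  where
  repeatingMiddle : Repeating S (a ∷ m)
  repeatingMiddle = subst (Repeating S) (inner-enclose x (a ∷ m) y) repeating

minimal⇔eertreeNode : (S w : List A) → MinimalUniquePalindrome S w ⇔
  (∃[ v ] ((pal {S = S} v ≡ w) × Unique S (pal v) × (∃[ u ] (Edge u v × Repeating S (pal u)))))
minimal⇔eertreeNode S w = mk⇔ toNode fromNode
  where
  toNode : MinimalUniquePalindrome S w →
    ∃[ v ] ((pal {S = S} v ≡ w) × Unique S (pal v) × (∃[ u ] (Edge u v × Repeating S (pal u))))
  toNode (palw , unique@(w≢[] , i , occurs , _) , repeating) =
    ordinary w w≢[] palw (i , occurs) , refl , unique , parentNode S w w≢[] palw (i , occurs) repeating
  fromNode : ∃[ v ] ((pal {S = S} v ≡ w) × Unique S (pal v) × (∃[ u ] (Edge u v × Repeating S (pal u)))) →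
    MinimalUniquePalindrome S w
  fromNode (ordinary w _ palw _ , refl , unique , u , (_ , palu≡inner) , repeating) =
    palw , unique , subst (Repeating S) palu≡inner repeating
  fromNode (zeroNode  , _ , (ε≢[] , _) , _) = ⊥-elim (ε≢[] refl)
  fromNode (minusNode , _ , (ε≢[] , _) , _) = ⊥-elim (ε≢[] refl)

lemma5 : {A : Set} (S w : List A) →
    IsMUPS S w ⇔ (∃[ v ] ((pal {S = S} v ≡ w) × Unique S (pal v) × (∃[ u ] (Edge u v × Repeating S (pal u)))))
lemma5 S w = ⇔-trans (isMUPS⇔minimal S w) (minimal⇔eertreeNode S w)
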